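{- Let $\mathbb{M}$ be a monster model of $T^+$, let $B\subseteq\mathbb{M}$ be small, and let $a_1,a_2\in\mathbb{M}\setminus B$ be distinct singletons with $a_1\equiv_B a_2$. If $\operatorname{tp}(a_1,a_2/B)$ is distinguished, then $\operatorname{tp}(a_1,a_2/B)$ is half-symmetric.
   Context: For a set $M$, $[M]^2$ is the set of 2-element subsets of $M$. A labeled switchboard is $(M,<,\uparrow,\downarrow)$ where $<$ is a strict partial order on $[M]^2$ with $\{x,y\},\{x,z\}$ incomparable for distinct $x,y,z$; $\uparrow,\downarrow$ are binary relations between $M$ and $[M]^2$ such that for every $a\in M$, $\{b,c\}\in[M]^2$ exactly one of $a\uparrow\{b,c\}$, $a\in\{b,c\}$, $a\downarrow\{b,c\}$ holds; $a\uparrow\{b,c\}<\{b',c'\}$ implies $a\uparrow\{b',c'\}$; and $a\downarrow\{b,c\}>\{b',c'\}$ implies $a\downarrow\{b',c'\}$. The class of finite labeled switchboards is a Fraïssé class; $T^+$ is the complete theory of its Fraïssé limit. $a_1\equiv_B a_2$ means same type over $B$. $\operatorname{tp}(a_1,a_2/B)$ is distinguished if: for any $b,c\in B$, if $\{a_1,b\}>\{a_2,c\}$ then there is $\{u,v\}\in[B]^2$ with $\{a_1,b\}>\{u,v\}>\{a_2,c\}$; and for any $b,c\in B$, if $\{a_1,b\}<\{a_2,c\}$ then there is $\{u,v\}\in[B]^2$ with $\{a_1,b\}<\{u,v\}<\{a_2,c\}$. $\operatorname{tp}(a_1,a_2/B)$ (with $a_1\equiv_B a_2$) is half-symmetric if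 $\{a_1,b\}<\{a_2,c\}\iff\{a_2,b\}<\{a_1,c\}$ for every $\{b,c\}\in[B]^2$. -}

module Defs where

open import Data.Nat using (ℕ; suc)
open import Data.Fin using (Fin; zero; suc)
open import Data.Sum using (_⊎_)
open import Data.Product using (Σ; ∃; _×_; _,_)
open import Data.Empty using (⊥)
open import Data.Unit using (⊤)
open import Relation.Nullary using (¬_)
open import Relation.Binary.PropositionalEquality using (_≡_; _≢_)
open import Relation.Unary using (Pred)
open import Function.Bundles using (_⇔_)
open import Level using (0ℓ)

-- A labeled switchboard (M,<,↑,↓).
-- 2-element subsets {x,y} are represented by (unordered) pairs of distinct
-- elements: all relations are required to be invariant under swapping the
-- two members of a pair and to hold only of genuine 2-element sets.
--   Lt a b c d   means  {a,b} < {c,d}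
--   Up a b c     means  a ↑ {b,c}
--   Down a b c   means  a ↓ {b,c}
record LabeledSwitchboard : Set₁ where
  field
    M    : Set
    Lt   : M → M → M → M → Set
    Up   : M → M → M → Set
    Down : M → M → M → Set
    Lt-pairˡ  : ∀ {a b c d} → Lt a b c d → a ≢ b
    Lt-pairʳ  : ∀ {a b c d} → Lt a b c d → c ≢ d
    Up-pair   : ∀ {a b c} → Up a b c → b ≢ c
    Down-pair : ∀ {a b c} → Down a b c → b ≢ c
    Lt-swapˡ  : ∀ {a b c d} → Lt a b c d → Lt b a c d
    Lt-swapʳ  : ∀ {a b c d} → Lt a b c d → Lt a b d c
    Up-swap   : ∀ {a b c} → Up a b c → Up a c b
    Down-swap : ∀ {a b c} → Down a b c → Down a c b
    Lt-irrefl : ∀ {a b} → ¬ Lt a b a b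
    Lt-trans  : ∀ {a b c d e f} → Lt a b c d → Lt c d e f → Lt a b e f
    Lt-incomp : ∀ {x y z} → x ≢ y → x ≢ z → y ≢ z → ¬ Lt x y x z
    trichotomy : ∀ a b c → b ≢ c → Up a b c ⊎ (a ≡ b ⊎ a ≡ c) ⊎ Down a b c
    Up-notMem   : ∀ {a b c} → Up a b c → a ≢ b × a ≢ c
    Down-notMem : ∀ {a b c} → Down a b c → a ≢ b × a ≢ c
    Up-notDown  : ∀ {a b c} → Up a b c → ¬ Down a b c
    Up-mono   : ∀ {a b c b' c'} → Up a b c → Lt b c b' c' → Up a b' c'
    Down-mono : ∀ {a b c b' c'} → Down a b c → Lt b' c' b c → Down a b' c'

module _ (S : LabeledSwitchboard) where
  open LabeledSwitchboard S

  -- First-order formulas in the language {=, <, ↑, ↓} with n free variables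
  -- and parameters from B ⊆ M.
  Term : Pred M 0ℓ → ℕ → Set
  Term B n = Fin n ⊎ Σ M B

  data Formula (B : Pred M 0ℓ) (n : ℕ) : Set where
    ⊤̇ ⊥̇  : Formula B n
    _≐_  : Term B n → Term B n → Formula B n
    lt   : Term B n → Term B n → Term B n → Term B n → Formula B n
    up   : Term B n → Term B n → Term B n → Formula B n
    down : Term B n → Term B n → Term B n → Formula B n
    ¬̇_   : Formula B n → Formula B n
    _∧̇_ _∨̇_ _⇒̇_ : Formula B n → Formula B n → Formula B n
    ∀̇ ∃̇  : Formula B (suc n) → Formula B n

  eval : {B : Pred M 0ℓ} {n : ℕ} → (Fin n → M) → Term B n → M
  eval ρ (Data.Sum.inj₁ i) = ρ i
  eval ρ (Data.Sum.inj₂ (m , _)) = m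

  extend : {n : ℕ} → M → (Fin n → M) → Fin (suc n) → M
  extend m ρ zero = m
  extend m ρ (suc i) = ρ i

  Sat : {B : Pred M 0ℓ} {n : ℕ} → Formula B n → (Fin n → M) → Set
  Sat ⊤̇ ρ = ⊤
  Sat ⊥̇ ρ = ⊥
  Sat (s ≐ t) ρ = eval ρ s ≡ eval ρ t
  Sat (lt s t u v) ρ = Lt (eval ρ s) (eval ρ t) (eval ρ u) (eval ρ v)
  Sat (up s t u) ρ = Up (eval ρ s) (eval ρ t) (eval ρ u)
  Sat (down s t u) ρ = Down (eval ρ s) (eval ρ t) (eval ρ u)
  Sat (¬̇ φ) ρ = ¬ Sat φ ρ
  Sat (φ ∧̇ ψ) ρ = Sat φ ρ × Sat ψ ρ
  Sat (φ ∨̇ ψ) ρ = Sat φ ρ ⊎ Sat ψ ρ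
  Sat (φ ⇒̇ ψ) ρ = Sat φ ρ → Sat ψ ρ
  Sat (∀̇ φ) ρ = (m : M) → Sat φ (extend m ρ)
  Sat (∃̇ φ) ρ = Σ M λ m → Sat φ (extend m ρ)

  SameType : Pred M 0ℓ → M → M → Set
  SameType B a₁ a₂ = (φ : Formula B 1) → Sat φ (λ _ → a₁) ⇔ Sat φ (λ _ → a₂)

  Distinguished : Pred M 0ℓ → M → M → Set
  Distinguished B a₁ a₂ =
    (∀ b c → B b → B c → Lt a₂ c a₁ b →
       ∃ λ u → ∃ λ v → B u × B v × u ≢ v × Lt a₂ c u v × Lt u v a₁ b)
    × (∀ b c → B b → B c → Lt a₁ b a₂ c →
       ∃ λ u → ∃ λ v → B u × B v × u ≢ v × Lt a₁ b u v × Lt u v a₂ c)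

  HalfSymmetric : Pred M 0ℓ → M → M → Set
  HalfSymmetric B a₁ a₂ =
    ∀ b c → B b → B c → b ≢ c → Lt a₁ b a₂ c ⇔ Lt a₂ b a₁ c

{-# OPTIONS --safe #-}
module Submission where

open import Defs
open import Relation.Unary using (Pred)
open import Relation.Nullary using (¬_)
open import Relation.Binary.PropositionalEquality using (_≢_)
open import Level using (0ℓ)
open import Data.Sum using (inj₁; inj₂)
open import Data.Product using (_,_)
open import Data.Fin using (zero)
open import Function.Bundles using (Equivalence; mk⇔)
open import Function.Properties.Equivalence using () renaming (sym to ⇔-sym)

-- If {a₁,b} < {a₂,c}, distinguishedness yields {u,v} ⊆ B with
-- {a₁,b} < {u,v} < {a₂,c}. Each of these two inequalities is a formula over B
-- in one free variable, so a₁ ≡_B a₂ lets us exchange a₁ and a₂ in both,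
-- and transitivity gives {a₂,b} < {a₁,c}; the converse is symmetric.

module _ (S : LabeledSwitchboard) where
  open LabeledSwitchboard S

  SameType-sym : ∀ {B x y} → SameType S B x y → SameType S B y x
  SameType-sym x≡y φ = ⇔-sym (x≡y φ)

  module _ {B : Pred M 0ℓ} {x y : M} (x≡y : SameType S B x y) where

    SameType-ltˡ : ∀ {b u v} → B b → B u → B v → Lt x b u v → Lt y b u v
    SameType-ltˡ {b} {u} {v} Bb Bu Bv =
      Equivalence.to (x≡y (lt (inj₁ zero) (inj₂ (b , Bb)) (inj₂ (u , Bu)) (inj₂ (v , Bv))))

    SameType-ltʳ : ∀ {u v c} → B u → B v → B c → Lt u v x c → Lt u v y c
    SameType-ltʳ {u} {v} {c} Bu Bv Bc =
      Equivalence.to (x≡y (lt (inj₂ (u , Bu)) (inj₂ (v , Bv)) (inj₁ zero) (inj₂ (c , Bc))))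

  lt-swap-through-parameters : ∀ {B x y b c u v} → SameType S B x y →
    B b → B c → B u → B v → Lt x b u v → Lt u v y c → Lt y b x c
  lt-swap-through-parameters x≡y Bb Bc Bu Bv xb<uv uv<yc =
    Lt-trans (SameType-ltˡ x≡y Bb Bu Bv xb<uv)
             (SameType-ltʳ (SameType-sym x≡y) Bu Bv Bc uv<yc)

lemma4p24 : (S : LabeledSwitchboard) →
    let open LabeledSwitchboard S in
    (B : Pred M 0ℓ) (a₁ a₂ : M) →
    ¬ B a₁ → ¬ B a₂ → a₁ ≢ a₂ →
    SameType S B a₁ a₂ →
    Distinguished S B a₁ a₂ →
    HalfSymmetric S B a₁ a₂
lemma4p24 S B a₁ a₂ _ _ _ a₁≡a₂ (between₂₁ , between₁₂) b c Bb Bc _ =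
  mk⇔ forward backward
  where
  open LabeledSwitchboard S

  forward : Lt a₁ b a₂ c → Lt a₂ b a₁ c
  forward a₁b<a₂c with between₁₂ b c Bb Bc a₁b<a₂c
  ... | u , v , Bu , Bv , _ , a₁b<uv , uv<a₂c =
    lt-swap-through-parameters S a₁≡a₂ Bb Bc Bu Bv a₁b<uv uv<a₂c

  backward : Lt a₂ b a₁ c → Lt a₁ b a₂ c
  backward a₂b<a₁c with between₂₁ c b Bc Bb a₂b<a₁c
  ... | u , v , Bu , Bv , _ , a₂b<uv , uv<a₁c =
    lt-swap-through-parameters S (SameType-sym S a₁≡a₂) Bb Bc Bu Bv a₂b<uv uv<a₁c
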